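{- Let $G$ be a finite simple graph that is odd torch-free and triangle-free. Then $\chi(G)\le 3$.
   Context: A hole is an induced cycle of length at least $4$, odd if its length is odd. An odd torch is obtained from an odd hole $C$ by adding two new vertices $x,y$ with $xy$ an edge, $x$ adjacent to no vertex of $C$, and the neighbours of $y$ on $C$ forming a nonempty stable set of $C$; odd torch-free means containing no odd torch as an induced subgraph. -}

module Defs where

open import Data.Nat using (ℕ; zero; suc; _+_; _*_; _≤_; _∸_)
open import Data.Empty using (⊥)
open import Data.Fin using (Fin; toℕ)
open import Data.Bool using (Bool; true; false; _∨_; _∧_)
open import Data.Product using (Σ; ∃; ∃-syntax; _×_; _,_)
open import Relation.Binary.PropositionalEquality using (_≡_; _≢_)
open import Function.Definitions using (Injective)

record Graph (n : ℕ) : Set where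
  field
    adj   : Fin n → Fin n → Bool
    sym   : ∀ u v → adj u v ≡ adj v u
    irrefl : ∀ v → adj v v ≡ false
open Graph public

_isInducedSubgraphOf_ : ∀ {m n} → Graph m → Graph n → Set
_isInducedSubgraphOf_ {m} {n} H G =
  Σ (Fin m → Fin n) λ f → Injective _≡_ _≡_ f × (∀ i j → adj G (f i) (f j) ≡ adj H i j)

TriangleFree : ∀ {n} → Graph n → Set
TriangleFree G = ∀ u v w → adj G u v ≡ true → adj G v w ≡ true → adj G u w ≡ false

natEq : ℕ → ℕ → Bool
natEq zero zero = true
natEq zero (suc _) = false
natEq (suc _) zero = false
natEq (suc a) (suc b) = natEq a b

cycAdj : (k : ℕ) → Fin k → Fin k → Bool
cycAdj k i j =
  natEq (toℕ j) (suc (toℕ i)) ∨ natEq (toℕ i) (suc (toℕ j)) ∨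
  (natEq (toℕ i) 0 ∧ natEq (toℕ j) (k ∸ 1)) ∨ (natEq (toℕ j) 0 ∧ natEq (toℕ i) (k ∸ 1))

Odd : ℕ → Set
Odd k = ∃[ m ] k ≡ suc (2 * m)

NonemptyStable : (k : ℕ) → (Fin k → Bool) → Set
NonemptyStable k S =
  (∃[ i ] S i ≡ true) ×
  (∀ i j → S i ≡ true → S j ≡ true → cycAdj k i j ≡ false)

-- The odd torch built from the odd hole C_k (k odd, k ≥ 5 since a hole has
-- length ≥ 4) and a set S of neighbours of y on the hole.
-- Vertex set Fin (2 + k): 0 = x, 1 = y, suc (suc i) = hole vertex i.
torchAdj : (k : ℕ) → (Fin k → Bool) → Fin (suc (suc k)) → Fin (suc (suc k)) → Bool
torchAdj k S Fin.zero Fin.zero = false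
torchAdj k S Fin.zero (Fin.suc Fin.zero) = true
torchAdj k S Fin.zero (Fin.suc (Fin.suc _)) = false
torchAdj k S (Fin.suc Fin.zero) Fin.zero = true
torchAdj k S (Fin.suc Fin.zero) (Fin.suc Fin.zero) = false
torchAdj k S (Fin.suc Fin.zero) (Fin.suc (Fin.suc j)) = S j
torchAdj k S (Fin.suc (Fin.suc _)) Fin.zero = false
torchAdj k S (Fin.suc (Fin.suc i)) (Fin.suc Fin.zero) = S i
torchAdj k S (Fin.suc (Fin.suc i)) (Fin.suc (Fin.suc j)) = cycAdj k i j

ContainsOddTorch : ∀ {n} → Graph n → Set
ContainsOddTorch {n} G =
  ∃[ k ] ∃[ S ] (4 ≤ k × Odd k × NonemptyStable k S ×
    Σ (Fin (suc (suc k)) → Fin n) λ f → Injective _≡_ _≡_ f ×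
      (∀ i j → adj G (f i) (f j) ≡ torchAdj k S i j))

OddTorchFree : ∀ {n} → Graph n → Set
OddTorchFree G = ContainsOddTorch G → ⊥

ProperColouring : ∀ {n} → Graph n → (c : ℕ) → (Fin n → Fin c) → Set
ProperColouring G c col = ∀ u v → adj G u v ≡ true → col u ≢ col v

ChromaticAtMost : ∀ {n} → Graph n → ℕ → Set
ChromaticAtMost {n} G c = ∃[ col ] ProperColouring G c col

-- In every component pick its least vertex as root and let S be the set of
-- neighbours of roots; by triangle-freeness S is stable.  If G − S were not
-- bipartite, a shortest odd closed walk in G − S would be an odd hole C.  The
-- root r of the component of C has no neighbour on C, since C avoids S, so along
-- a walk from C to r there is an edge xy with y adjacent to C and x not; then
-- C, x, y form an odd torch.  Hence G − S is 2-coloured by the parity of walks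
-- to the roots, and S receives the third colour.
module Submission where

open import Defs hiding (sym)
open import Data.Bool using (Bool; true; false; not; _∧_; _∨_; if_then_else_)
open import Data.Bool.Properties using (∨-zeroʳ; not-¬) renaming (_≟_ to _≟ᵇ_)
open import Data.Empty using (⊥; ⊥-elim)
open import Data.Fin using (Fin; zero; suc; toℕ; fromℕ; fromℕ<; inject₁)
open import Data.Fin.Properties
  using (toℕ<n; toℕ-injective; toℕ-fromℕ<; any?; pigeonhole; fromℕ≢inject₁; inject₁-injective)
  renaming (_≟_ to _≟ᶠ_)
open import Data.Nat using (ℕ; zero; suc; _+_; _∸_; _≤_; _<_; z≤n; s≤s; s≤s⁻¹; _<?_; parity)
open import Data.Nat.Induction using (<-wellFounded)
open import Data.Nat.Properties
open import Data.Parity.Base using (Parity; 0ℙ; 1ℙ; _⁻¹) renaming (_+_ to _ℙ+_)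
open import Data.Parity.Properties using (+-homo-+; suc-homo-⁻¹; ⁻¹-selfInverse; p+p⁻¹≡1ℙ)
  renaming (_≟_ to _≟ℙ_)
open import Data.Product using (∃; ∃₂; _×_; _,_; proj₁; proj₂)
open import Data.Sum using (_⊎_; inj₁; inj₂)
open import Function.Base using (_∘_)
open import Function.Definitions using (Injective)
open import Induction.WellFounded using (Acc; acc)
open import Relation.Binary.Definitions using (tri<; tri≈; tri>)
open import Relation.Binary.PropositionalEquality
open import Relation.Nullary using (¬_; Dec; yes; no; contradiction)
open import Relation.Nullary.Decidable using (_×-dec_; map′)
open import Relation.Unary using (Decidable)

∨-true : ∀ {a b} → a ∨ b ≡ true → a ≡ true ⊎ b ≡ true
∨-true {true} _ = inj₁ refl
∨-true {false} h = inj₂ h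

∧-true : ∀ {a b} → a ∧ b ≡ true → a ≡ true × b ≡ true
∧-true {true} {true} _ = refl , refl

∨-introˡ : ∀ {a b} → a ≡ true → a ∨ b ≡ true
∨-introˡ refl = refl

∨-introʳ : ∀ a {b} → b ≡ true → a ∨ b ≡ true
∨-introʳ a refl = ∨-zeroʳ a

≡true-ext : ∀ {a b} → (a ≡ true → b ≡ true) → (b ≡ true → a ≡ true) → a ≡ b
≡true-ext {true} a⇒b _ = sym (a⇒b refl)
≡true-ext {false} {true} _ b⇒a = b⇒a refl
≡true-ext {false} {false} _ _ = refl

natEq⇒≡ : ∀ {m n} → natEq m n ≡ true → m ≡ n
natEq⇒≡ {zero} {zero} _ = refl
natEq⇒≡ {suc m} {suc n} h = cong suc (natEq⇒≡ h)

≡⇒natEq : ∀ {m n} → m ≡ n → natEq m n ≡ true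
≡⇒natEq {zero} refl = refl
≡⇒natEq {suc m} refl = ≡⇒natEq {m} refl

parity≡1ℙ⇒Odd : ∀ m → parity m ≡ 1ℙ → Odd m
parity≡1ℙ⇒Odd (suc zero) _ = 0 , refl
parity≡1ℙ⇒Odd (suc (suc m)) odd with parity≡1ℙ⇒Odd m odd
... | h , refl = suc h , cong (2 +_) (sym (+-suc h (h + 0)))

parity-+-odd : ∀ m n → parity (m + n) ≡ 1ℙ → parity m ≡ 1ℙ ⊎ parity n ≡ 1ℙ
parity-+-odd m n odd with parity m | parity n | +-homo-+ m n
... | 1ℙ | _ | _ = inj₁ refl
... | 0ℙ | _ | eq = inj₂ (trans (sym eq) odd)

parity-+-suc : ∀ m n → parity m ≡ parity n → parity (m + suc n) ≡ 1ℙ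
parity-+-suc m n same = begin
  parity (m + suc n)           ≡⟨ +-homo-+ m (suc n) ⟩
  parity m ℙ+ parity (suc n)   ≡⟨ cong₂ _ℙ+_ same (sym (⁻¹-selfInverse (suc-homo-⁻¹ n))) ⟩
  parity n ℙ+ parity n ⁻¹      ≡⟨ p+p⁻¹≡1ℙ (parity n) ⟩
  1ℙ                           ∎
  where open ≡-Reasoning

bit : Parity → Fin 2
bit 0ℙ = zero
bit 1ℙ = suc zero

bit-injective : ∀ {p q} → bit p ≡ bit q → p ≡ q
bit-injective {0ℙ} {0ℙ} _ = refl
bit-injective {1ℙ} {1ℙ} _ = refl

arc-lengths : ∀ {i j k} → i ≤ j → j ≤ k → (j ∸ i) + ((k ∸ j) + i) ≡ k
arc-lengths {i} {j} {k} i≤j j≤k = begin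
  (j ∸ i) + ((k ∸ j) + i) ≡⟨ cong ((j ∸ i) +_) (+-comm (k ∸ j) i) ⟩
  (j ∸ i) + (i + (k ∸ j)) ≡⟨ sym (+-assoc (j ∸ i) i (k ∸ j)) ⟩
  (j ∸ i) + i + (k ∸ j)   ≡⟨ cong (_+ (k ∸ j)) (m∸n+n≡m i≤j) ⟩
  j + (k ∸ j)             ≡⟨ m+[n∸m]≡n j≤k ⟩
  k                       ∎
  where open ≡-Reasoning

co-arc-shorter : ∀ {i j k} → i < j → j ≤ k → (k ∸ j) + i < k
co-arc-shorter {j = j} {k} i<j j≤k =
  subst ((k ∸ j) + _ <_) (m∸n+n≡m j≤k) (+-monoʳ-< (k ∸ j) i<j)

inner-arc-shorter : ∀ {i j k} → i < j → j < k → ¬ (i ≡ 0 × j ≡ k ∸ 1) → suc (j ∸ i) < k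
inner-arc-shorter {zero} _ j<k not-wrap =
  ≤∧≢⇒< j<k (λ j+1≡k → not-wrap (refl , cong (_∸ 1) j+1≡k))
inner-arc-shorter {suc i} i<j j<k _ = ≤-<-trans (∸-monoʳ-< (s≤s z≤n) (<⇒≤ i<j)) j<k

IsLeast : (ℕ → Set) → ℕ → Set
IsLeast P m = P m × (∀ {j} → j < m → ¬ P j)

least : ∀ {P : ℕ → Set} → Decidable P → ∀ {m} → P m → ∃ (IsLeast P)
least {P} P? {m} = go m (<-wellFounded m)
  where
  go : ∀ m → Acc _<_ m → P m → ∃ (IsLeast P)
  go m (acc smaller) pm with anyUpTo? P? m
  ... | yes (j , j<m , pj) = go j (smaller j<m) pj
  ... | no none = m , pm , λ j<m pj → none (_ , j<m , pj)

least-unique : ∀ {P Q : ℕ → Set} {l l′} → (∀ {j} → P j → Q j) → (∀ {j} → Q j → P j) →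
               IsLeast P l → IsLeast Q l′ → l ≡ l′
least-unique {l = l} {l′} P⇒Q Q⇒P (pl , below-l) (ql′ , below-l′) with <-cmp l l′
... | tri< l<l′ _ _ = contradiction (P⇒Q pl) (below-l′ l<l′)
... | tri≈ _ l≡l′ _ = l≡l′
... | tri> _ _ l′<l = contradiction (Q⇒P ql′) (below-l l′<l)

-- Induced subgraphs and colourings

restrict : ∀ {n} → Graph n → (Fin n → Bool) → Graph n
restrict G A = record
  { adj = λ u v → A u ∧ A v ∧ adj G u v
  ; sym = symmetric
  ; irrefl = irreflexive
  }
  where
  symmetric : ∀ u v → A u ∧ A v ∧ adj G u v ≡ A v ∧ A u ∧ adj G v u
  symmetric u v with A u | A v
  ... | true | true = Graph.sym G u v
  ... | true | false = refl
  ... | false | true = refl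
  ... | false | false = refl
  irreflexive : ∀ v → A v ∧ A v ∧ adj G v v ≡ false
  irreflexive v with A v
  ... | true = irrefl G v
  ... | false = refl

module _ {n} {G : Graph n} {A : Fin n → Bool} where

  restrict-adj : ∀ {u v} → A u ≡ true → A v ≡ true → adj (restrict G A) u v ≡ adj G u v
  restrict-adj Au Av rewrite Au | Av = refl

  restrict-edge : ∀ {u v} → adj (restrict G A) u v ≡ true →
                  A u ≡ true × A v ≡ true × adj G u v ≡ true
  restrict-edge e = let (Au , rest) = ∧-true e ; (Av , uv) = ∧-true rest in Au , Av , uv

  restrict-triangleFree : TriangleFree G → TriangleFree (restrict G A)
  restrict-triangleFree tf u v w uv vw =
    let (Au , _ , uv′) = restrict-edge uv ; (_ , Aw , vw′) = restrict-edge vw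
    in trans (restrict-adj Au Aw) (tf u v w uv′ vw′)

Stable : ∀ {n} → Graph n → (Fin n → Bool) → Set
Stable G S = ∀ {u v} → S u ≡ true → S v ≡ true → adj G u v ≢ true

extend-by-stable : ∀ {n c} {G : Graph n} {S : Fin n → Bool} → Stable G S →
                   ChromaticAtMost (restrict G (not ∘ S)) c → ChromaticAtMost G (suc c)
extend-by-stable {n} {c} {G} {S} stable (col , proper) = col′ , proper′
  where
  col′ : Fin n → Fin (suc c)
  col′ u = if S u then fromℕ c else inject₁ (col u)
  proper′ : ProperColouring G (suc c) col′
  proper′ u v e with S u in Su | S v in Sv
  ... | true | true = ⊥-elim (stable Su Sv e)
  ... | true | false = fromℕ≢inject₁
  ... | false | true = fromℕ≢inject₁ ∘ sym
  ... | false | false =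
    proper u v (trans (restrict-adj {G = G} {not ∘ S} (cong not Su) (cong not Sv)) e)
    ∘ inject₁-injective

-- Odd holes

CycleStep : ℕ → ℕ → ℕ → Set
CycleStep k i j = j ≡ suc i ⊎ (i ≡ 0 × j ≡ k ∸ 1)

cycAdj-sound : ∀ {k} {i j : Fin k} → cycAdj k i j ≡ true →
               CycleStep k (toℕ i) (toℕ j) ⊎ CycleStep k (toℕ j) (toℕ i)
cycAdj-sound h with ∨-true h
... | inj₁ next = inj₁ (inj₁ (natEq⇒≡ next))
... | inj₂ h′ with ∨-true h′
... | inj₁ prev = inj₂ (inj₁ (natEq⇒≡ prev))
... | inj₂ h″ with ∨-true h″
... | inj₁ wrap = let (i0 , jk) = ∧-true wrap in inj₁ (inj₂ (natEq⇒≡ i0 , natEq⇒≡ jk))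
... | inj₂ wrap = let (j0 , ik) = ∧-true wrap in inj₂ (inj₂ (natEq⇒≡ j0 , natEq⇒≡ ik))

cycAdj-complete : ∀ {k} {i j : Fin k} →
                  CycleStep k (toℕ i) (toℕ j) ⊎ CycleStep k (toℕ j) (toℕ i) → cycAdj k i j ≡ true
cycAdj-complete (inj₁ (inj₁ next)) = ∨-introˡ (≡⇒natEq next)
cycAdj-complete {i = i} {j} (inj₂ (inj₁ prev)) =
  ∨-introʳ (natEq (toℕ j) (suc (toℕ i))) (∨-introˡ (≡⇒natEq prev))
cycAdj-complete {i = i} {j} (inj₁ (inj₂ (i0 , jk))) =
  ∨-introʳ (natEq (toℕ j) (suc (toℕ i))) (∨-introʳ (natEq (toℕ i) (suc (toℕ j)))
    (∨-introˡ (cong₂ _∧_ (≡⇒natEq i0) (≡⇒natEq jk))))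
cycAdj-complete {k} {i} {j} (inj₂ (inj₂ (j0 , ik))) =
  ∨-introʳ (natEq (toℕ j) (suc (toℕ i))) (∨-introʳ (natEq (toℕ i) (suc (toℕ j)))
    (∨-introʳ (natEq (toℕ i) 0 ∧ natEq (toℕ j) (k ∸ 1)) (cong₂ _∧_ (≡⇒natEq j0) (≡⇒natEq ik))))

cycAdj-successor : ∀ {k} (i : Fin k) → ∃ λ j → cycAdj k i j ≡ true
cycAdj-successor {suc k} i with suc (toℕ i) <? suc k
... | yes i+1<k = fromℕ< i+1<k , cycAdj-complete (inj₁ (inj₁ (toℕ-fromℕ< i+1<k)))
... | no i+1≮k = zero , cycAdj-complete (inj₂ (inj₂ (refl , i≡k)))
  where
  i≡k : toℕ i ≡ k
  i≡k = ≤-antisym (s≤s⁻¹ (toℕ<n i)) (s≤s⁻¹ (≮⇒≥ i+1≮k))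

record OddHole {n} (G : Graph n) : Set where
  field
    k : ℕ
    4≤k : 4 ≤ k
    k-odd : Odd k
    C : Fin k → Fin n
    C-injective : Injective _≡_ _≡_ C
    C-induced : ∀ i j → adj G (C i) (C j) ≡ cycAdj k i j

  C-neighbour : ∀ i → ∃ λ j → adj G (C i) (C j) ≡ true
  C-neighbour i = let (j , ij) = cycAdj-successor i in j , trans (C-induced i j) ij

unrestrict : ∀ {n} {G : Graph n} {A} (h : OddHole (restrict G A)) →
             ∃ λ (h′ : OddHole G) → ∀ i → A (OddHole.C h′ i) ≡ true
unrestrict {G = G} {A} h =
  record { k = k ; 4≤k = 4≤k ; k-odd = k-odd ; C = C ; C-injective = C-injective
         ; C-induced = induced } ,
  inside
  where
  open OddHole h
  inside : ∀ i → A (C i) ≡ true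
  inside i = proj₁ (restrict-edge {G = G} {A} (proj₂ (C-neighbour i)))
  induced : ∀ i j → adj G (C i) (C j) ≡ cycAdj k i j
  induced i j = trans (sym (restrict-adj {G = G} {A} (inside i) (inside j))) (C-induced i j)

-- Walks

module Walks {n} (G : Graph n) where

  Edge : Fin n → Fin n → Set
  Edge u v = adj G u v ≡ true

  edge? : ∀ u v → Dec (Edge u v)
  edge? u v = adj G u v ≟ᵇ true

  edge-sym : ∀ {u v} → Edge u v → Edge v u
  edge-sym {u} {v} e = trans (Graph.sym G v u) e

  edge-irrefl : ∀ {u} → ¬ Edge u u
  edge-irrefl {u} e = not-¬ e (irrefl G u)

  record Walk (a b : Fin n) (L : ℕ) : Set where
    field
      vertex : ℕ → Fin n
      start : vertex 0 ≡ a
      end : vertex L ≡ b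
      step : ∀ {i} → i < L → Edge (vertex i) (vertex (suc i))
  open Walk public

  [] : ∀ {a} → Walk a a 0
  [] {a} = record { vertex = λ _ → a ; start = refl ; end = refl ; step = λ () }

  infixr 5 _◅_ _++_

  _◅_ : ∀ {a b c L} → Edge a b → Walk b c L → Walk a c (suc L)
  _◅_ {a} {L = L} e W = record { vertex = v ; start = refl ; end = end W ; step = s }
    where
    v : ℕ → Fin n
    v zero = a
    v (suc i) = vertex W i
    s : ∀ {i} → i < suc L → Edge (v i) (v (suc i))
    s {zero} _ = subst (Edge a) (sym (start W)) e
    s {suc i} i+1<L+1 = step W (s≤s⁻¹ i+1<L+1)

  empty-walk : ∀ {a b} → Walk a b 0 → a ≡ b
  empty-walk W = trans (sym (start W)) (end W)

  closes : ∀ {a L} (W : Walk a a L) → vertex W L ≡ vertex W 0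
  closes W = trans (end W) (sym (start W))

  first-edge : ∀ {a c L} (W : Walk a c (suc L)) → Edge a (vertex W 1)
  first-edge W = subst (λ v → Edge v _) (start W) (step W {0} (s≤s z≤n))

  tail : ∀ {a c L} (W : Walk a c (suc L)) → Walk (vertex W 1) c L
  tail W = record { vertex = vertex W ∘ suc ; start = refl ; end = end W ; step = step W ∘ s≤s }

  _++_ : ∀ {a b c L M} → Walk a b L → Walk b c M → Walk a c (L + M)
  _++_ {L = zero} W V = subst (λ v → Walk v _ _) (sym (empty-walk W)) V
  _++_ {L = suc L} W V = first-edge W ◅ tail W ++ V

  reverse : ∀ {a b L} → Walk a b L → Walk b a L
  reverse {L = L} W = record
    { vertex = λ t → vertex W (L ∸ t)
    ; start = end W
    ; end = trans (cong (vertex W) (n∸n≡0 L)) (start W)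
    ; step = λ {t} t<L →
        subst (λ i → Edge (vertex W i) (vertex W (L ∸ suc t))) (sym (+-∸-assoc 1 t<L))
              (edge-sym (step W {L ∸ suc t} (∸-monoʳ-< (s≤s z≤n) t<L)))
    }

  take : ∀ {a b L} (W : Walk a b L) {i} → i ≤ L → Walk a (vertex W i) i
  take W i≤L = record
    { vertex = vertex W ; start = start W ; end = refl ; step = λ t<i → step W (<-≤-trans t<i i≤L) }

  drop : ∀ {a b L} (W : Walk a b L) {i} → i ≤ L → Walk (vertex W i) b (L ∸ i)
  drop W {i} i≤L = record
    { vertex = λ t → vertex W (t + i)
    ; start = refl
    ; end = trans (cong (vertex W) (m∸n+n≡m i≤L)) (end W)
    ; step = λ {t} t<L∸i → step W (m≤o∸n⇒m+n≤o (suc t) i≤L t<L∸i)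
    }

  walk? : ∀ L a b → Dec (Walk a b L)
  walk? zero a b = map′ (λ { refl → [] }) empty-walk (a ≟ᶠ b)
  walk? (suc L) a b = map′ (λ (c , e , W) → e ◅ W) (λ W → vertex W 1 , first-edge W , tail W)
                           (any? λ c → edge? a c ×-dec walk? L c b)

  shortcut : ∀ {a b L} → Walk a b L → n ≤ L → ∃ λ L′ → L′ < L × Walk a b L′
  shortcut {b = b} {L} W n≤L with pigeonhole (s≤s n≤L) (vertex W ∘ toℕ)
  ... | i , j , i<j , same = toℕ i + (L ∸ toℕ j) , shorter ,
        take W (≤-trans (<⇒≤ i<j) j≤L) ++ subst (λ v → Walk v b _) (sym same) (drop W j≤L)
    where
    j≤L : toℕ j ≤ L
    j≤L = s≤s⁻¹ (toℕ<n j)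
    shorter : toℕ i + (L ∸ toℕ j) < L
    shorter = subst (toℕ i + (L ∸ toℕ j) <_) (m+[n∸m]≡n j≤L) (+-monoˡ-< (L ∸ toℕ j) i<j)

  shortest-walk-length : ∀ {a b L} → IsLeast (Walk a b) L → L < n
  shortest-walk-length {L = L} (W , none-shorter) with L <? n
  ... | yes L<n = L<n
  ... | no L≮n =
    let (_ , L′<L , W′) = shortcut W (≮⇒≥ L≮n) in contradiction W′ (none-shorter L′<L)

  Reach : Fin n → Fin n → Set
  Reach a b = ∃ (Walk a b)

  reach? : ∀ a b → Dec (Reach a b)
  reach? a b = map′ (λ (L , _ , W) → L , W) bounded (anyUpTo? (λ L → walk? L a b) n)
    where
    bounded : Reach a b → ∃ λ L → L < n × Walk a b L
    bounded (_ , W) = let (L , (W′ , minimal)) = least (λ L → walk? L a b) W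
                      in L , shortest-walk-length (W′ , minimal) , W′

  reach-trans : ∀ {a b c} → Reach a b → Reach b c → Reach a c
  reach-trans (_ , W) (_ , V) = _ , W ++ V

  reach-sym : ∀ {a b} → Reach a b → Reach b a
  reach-sym (_ , W) = _ , reverse W

  edge-reach : ∀ {a b} → Edge a b → Reach a b
  edge-reach e = 1 , e ◅ []

  ReachableIndex : Fin n → ℕ → Set
  ReachableIndex a m = ∃ λ v → toℕ v ≡ m × Reach a v

  least-reachable-index : ∀ a → ∃ (IsLeast (ReachableIndex a))
  least-reachable-index a =
    least (λ m → any? λ v → (toℕ v ≟ m) ×-dec reach? a v) (a , refl , 0 , [])

  root : Fin n → Fin n
  root a = proj₁ (proj₁ (proj₂ (least-reachable-index a)))

  root-reach : ∀ a → Reach a (root a)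
  root-reach a = proj₂ (proj₂ (proj₁ (proj₂ (least-reachable-index a))))

  root-cong : ∀ {a b} → Reach a b → root a ≡ root b
  root-cong {a} {b} r with least-reachable-index a | least-reachable-index b
  ... | _ , least-a@((_ , u≡l , _) , _) | _ , least-b@((_ , v≡l′ , _) , _) =
    toℕ-injective (trans u≡l (trans (least-unique a⇒b b⇒a least-a least-b) (sym v≡l′)))
    where
    a⇒b : ∀ {m} → ReachableIndex a m → ReachableIndex b m
    a⇒b (x , eq , r′) = x , eq , reach-trans (reach-sym r) r′
    b⇒a : ∀ {m} → ReachableIndex b m → ReachableIndex a m
    b⇒a (x , eq , r′) = x , eq , reach-trans r r′

  root-neighbour : ∀ {u a} → Edge u (root a) → Edge u (root u)
  root-neighbour {u} {a} e =
    subst (Edge u) (trans (root-cong (root-reach a)) (sym (root-cong (edge-reach e)))) e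

  crossing : ∀ {P : Fin n → Set} → Decidable P → ∀ {a b L} → Walk a b L → P a → ¬ P b →
             ∃₂ λ u v → Edge u v × P u × ¬ P v
  crossing {P} P? {L = zero} W Pa ¬Pb = contradiction (subst P (empty-walk W) Pa) ¬Pb
  crossing P? {L = suc L} W Pa ¬Pb with P? (vertex W 1)
  ... | yes P1 = crossing P? (tail W) P1 ¬Pb
  ... | no ¬P1 = _ , _ , first-edge W , Pa , ¬P1

  OddClosedWalk : ℕ → Set
  OddClosedWalk L = ∃ λ a → Walk a a L × parity L ≡ 1ℙ

  oddClosedWalk? : ∀ L → Dec (OddClosedWalk L)
  oddClosedWalk? L = any? λ a → walk? L a a ×-dec (parity L ≟ℙ 1ℙ)

  bipartite : ¬ ∃ OddClosedWalk → ChromaticAtMost G 2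
  bipartite no-odd = colour , proper
    where
    depth : Fin n → ℕ
    depth u = proj₁ (root-reach u)
    colour : Fin n → Fin 2
    colour u = bit (parity (depth u))
    proper : ProperColouring G 2 colour
    proper u v e same =
      no-odd (_ , root u , closed , parity-+-suc (depth u) (depth v) (bit-injective same))
      where
      closed : Walk (root u) (root u) (depth u + suc (depth v))
      closed = reverse (proj₂ (root-reach u)) ++ e ◅
               subst (λ r → Walk v r _) (sym (root-cong (edge-reach e))) (proj₂ (root-reach v))

  5≤odd-closed-walk-length : TriangleFree G → ∀ {a L} → Walk a a L → parity L ≡ 1ℙ → 5 ≤ L
  5≤odd-closed-walk-length tf {L = 1} W _ =
    ⊥-elim (edge-irrefl (subst (Edge _) (closes W) (step W {0} (s≤s z≤n))))
  5≤odd-closed-walk-length tf {L = 3} W _ =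
    ⊥-elim (not-¬ (edge-sym (subst (Edge _) (closes W) (step W {2} (s≤s (s≤s (s≤s z≤n))))))
                  (tf _ _ _ (step W {0} (s≤s z≤n)) (step W {1} (s≤s (s≤s z≤n)))))
  5≤odd-closed-walk-length tf {L = suc (suc (suc (suc (suc _))))} _ _ =
    s≤s (s≤s (s≤s (s≤s (s≤s z≤n))))

-- A shortest odd closed walk is an odd hole

module ShortestOddClosedWalk {n} {G : Graph n} (tf : TriangleFree G)
  {k a} (W : Walks.Walk G a a k) (odd : parity k ≡ 1ℙ)
  (none-shorter : ∀ {m} → m < k → ¬ Walks.OddClosedWalk G m) where

  open Walks G

  w : ℕ → Fin n
  w = vertex W

  no-shorter-odd-pair : ∀ {p q x y} → p < k → q < k → parity (p + q) ≡ 1ℙ →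
                        Walk x x p → Walk y y q → ⊥
  no-shorter-odd-pair {p} {q} p<k q<k odd-sum U V with parity-+-odd p q odd-sum
  ... | inj₁ odd-p = none-shorter p<k (_ , U , odd-p)
  ... | inj₂ odd-q = none-shorter q<k (_ , V , odd-q)

  arc : ∀ {i j} → i < j → j < k → Walk (w i) (w j) (j ∸ i)
  arc i<j j<k = drop (take W (<⇒≤ j<k)) (<⇒≤ i<j)

  co-arc : ∀ {i j} → i < j → j < k → Walk (w j) (w i) ((k ∸ j) + i)
  co-arc i<j j<k = drop W (<⇒≤ j<k) ++ take W (<⇒≤ (<-trans i<j j<k))

  arcs-odd : ∀ {i j} → i < j → j < k → parity ((j ∸ i) + ((k ∸ j) + i)) ≡ 1ℙ
  arcs-odd i<j j<k = subst (λ m → parity m ≡ 1ℙ) (sym (arc-lengths (<⇒≤ i<j) (<⇒≤ j<k))) odd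

  distinct : ∀ {i j} → i < j → j < k → w i ≢ w j
  distinct {i} {j} i<j j<k wi≡wj = no-shorter-odd-pair
    (≤-<-trans (m∸n≤m j i) j<k) (co-arc-shorter i<j (<⇒≤ j<k)) (arcs-odd i<j j<k)
    (subst (λ v → Walk (w i) v _) (sym wi≡wj) (arc i<j j<k))
    (subst (λ v → Walk v (w i) _) (sym wi≡wj) (co-arc i<j j<k))

  -- A chord splits the walk into two closed walks of total length k + 2,
  -- both shorter than k unless the chord is a step of the cycle.
  chordless : ∀ {i j} → i < j → j < k → Edge (w i) (w j) → CycleStep k i j
  chordless {i} {j} i<j j<k e with j ≟ suc i | (i ≟ 0) ×-dec (j ≟ k ∸ 1)
  ... | yes next | _ = inj₁ next
  ... | no _ | yes wrap = inj₂ wrap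
  ... | no not-next | no not-wrap = ⊥-elim (no-shorter-odd-pair
    (inner-arc-shorter i<j j<k not-wrap) outer-shorter
    (subst (λ m → parity m ≡ 1ℙ) (cong suc (sym (+-suc (j ∸ i) _))) (arcs-odd i<j j<k))
    (edge-sym e ◅ arc i<j j<k)
    (e ◅ co-arc i<j j<k))
    where
    outer-shorter : suc ((k ∸ j) + i) < k
    outer-shorter = subst (_< k) (+-suc (k ∸ j) i)
      (co-arc-shorter (≤∧≢⇒< i<j (not-next ∘ sym)) (<⇒≤ j<k))

  C : Fin k → Fin n
  C i = w (toℕ i)

  C-injective : Injective _≡_ _≡_ C
  C-injective {i} {j} eq with <-cmp (toℕ i) (toℕ j)
  ... | tri< i<j _ _ = ⊥-elim (distinct i<j (toℕ<n j) eq)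
  ... | tri≈ _ i≡j _ = toℕ-injective i≡j
  ... | tri> _ _ j<i = ⊥-elim (distinct j<i (toℕ<n i) (sym eq))

  cycle-edge : ∀ {i j} → j < k → CycleStep k i j → Edge (w i) (w j)
  cycle-edge {i} j<k (inj₁ refl) = step W (<-trans (n<1+n i) j<k)
  cycle-edge j<k (inj₂ (refl , refl)) =
    edge-sym (subst (Edge _) (trans (cong w (m+[n∸m]≡n {1} (≤-<-trans z≤n j<k))) (closes W))
                    (step W j<k))

  C-edge⇒cycAdj : ∀ i j → Edge (C i) (C j) → cycAdj k i j ≡ true
  C-edge⇒cycAdj i j e with <-cmp (toℕ i) (toℕ j)
  ... | tri< i<j _ _ = cycAdj-complete (inj₁ (chordless i<j (toℕ<n j) e))
  ... | tri≈ _ i≡j _ = ⊥-elim (edge-irrefl (subst (λ m → Edge (C i) (w m)) (sym i≡j) e))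
  ... | tri> _ _ j<i = cycAdj-complete (inj₂ (chordless j<i (toℕ<n i) (edge-sym e)))

  cycAdj⇒C-edge : ∀ i j → cycAdj k i j ≡ true → Edge (C i) (C j)
  cycAdj⇒C-edge i j h with cycAdj-sound h
  ... | inj₁ i→j = cycle-edge (toℕ<n j) i→j
  ... | inj₂ j→i = edge-sym (cycle-edge (toℕ<n i) j→i)

  hole : OddHole G
  hole = record
    { k = k
    ; 4≤k = <⇒≤ (5≤odd-closed-walk-length tf W odd)
    ; k-odd = parity≡1ℙ⇒Odd k odd
    ; C = C
    ; C-injective = C-injective
    ; C-induced = λ i j → ≡true-ext (C-edge⇒cycAdj i j) (cycAdj⇒C-edge i j)
    }

oddHole : ∀ {n} {G : Graph n} → TriangleFree G → ∃ (Walks.OddClosedWalk G) → OddHole G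
oddHole {G = G} tf (_ , odd-walk) with least (Walks.oddClosedWalk? G) odd-walk
... | _ , (_ , W , odd) , none-shorter = ShortestOddClosedWalk.hole tf W odd none-shorter

-- Odd torches

module _ {n} {G : Graph n} (h : OddHole G) where
  open Walks G
  open OddHole h

  NearHole : Fin n → Set
  NearHole v = ∃ λ j → Edge v (C j)

  module Torch (tf : TriangleFree G) {x y} (xy : Edge x y) (x-far : ¬ NearHole x) where

    N : Fin k → Bool
    N j = adj G y (C j)

    N-stable : ∀ i j → N i ≡ true → N j ≡ true → cycAdj k i j ≡ false
    N-stable i j yi yj = trans (sym (C-induced i j)) (tf (C i) y (C j) (edge-sym yi) yj)

    f : Fin (suc (suc k)) → Fin n
    f zero = x
    f (suc zero) = y
    f (suc (suc i)) = C i

    x∉C : ∀ i → x ≢ C i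
    x∉C i refl = x-far (C-neighbour i)

    y∉C : ∀ i → y ≢ C i
    y∉C i refl = x-far (i , xy)

    x≢y : x ≢ y
    x≢y refl = edge-irrefl xy

    f-injective : Injective _≡_ _≡_ f
    f-injective {zero} {zero} _ = refl
    f-injective {zero} {suc zero} eq = ⊥-elim (x≢y eq)
    f-injective {zero} {suc (suc j)} eq = ⊥-elim (x∉C j eq)
    f-injective {suc zero} {zero} eq = ⊥-elim (x≢y (sym eq))
    f-injective {suc zero} {suc zero} _ = refl
    f-injective {suc zero} {suc (suc j)} eq = ⊥-elim (y∉C j eq)
    f-injective {suc (suc i)} {zero} eq = ⊥-elim (x∉C i (sym eq))
    f-injective {suc (suc i)} {suc zero} eq = ⊥-elim (y∉C i (sym eq))
    f-injective {suc (suc i)} {suc (suc j)} eq with refl ← C-injective eq = refl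

    x≁C : ∀ j → adj G x (C j) ≡ false
    x≁C j with adj G x (C j) in e
    ... | true = ⊥-elim (x-far (j , e))
    ... | false = refl

    f-induced : ∀ i j → adj G (f i) (f j) ≡ torchAdj k N i j
    f-induced zero zero = irrefl G x
    f-induced zero (suc zero) = xy
    f-induced zero (suc (suc j)) = x≁C j
    f-induced (suc zero) zero = edge-sym xy
    f-induced (suc zero) (suc zero) = irrefl G y
    f-induced (suc zero) (suc (suc j)) = refl
    f-induced (suc (suc i)) zero = trans (Graph.sym G (C i) x) (x≁C i)
    f-induced (suc (suc i)) (suc zero) = Graph.sym G (C i) y
    f-induced (suc (suc i)) (suc (suc j)) = C-induced i j

  oddTorch : TriangleFree G → ∀ {x y} → Edge x y → ¬ NearHole x → NearHole y → ContainsOddTorch G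
  oddTorch tf xy x-far y-near = k , N , 4≤k , k-odd , (y-near , N-stable) , f , f-injective , f-induced
    where open Torch tf xy x-far

  oddTorch-from-walk : TriangleFree G → ∀ i {r L} → Walk (C i) r L → ¬ NearHole r →
                       ContainsOddTorch G
  oddTorch-from-walk tf i W r-far
    with crossing (λ v → any? λ j → edge? v (C j)) W (C-neighbour i) r-far
  ... | _ , _ , yx , y-near , x-far = oddTorch tf (edge-sym yx) x-far y-near

module _ {n} (G : Graph n) where
  open Walks G

  rootNeighbour : Fin n → Bool
  rootNeighbour u = adj G u (root u)

  rootNeighbour-stable : TriangleFree G → Stable G rootNeighbour
  rootNeighbour-stable tf {u} {v} Su Sv e =
    not-¬ (subst (Edge u) (root-cong (edge-reach e)) Su) (tf u v (root v) e Sv)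

  root-far-from-hole : (h : OddHole G) → (∀ i → not (rootNeighbour (OddHole.C h i)) ≡ true) →
                       ∀ i → ¬ NearHole h (root (OddHole.C h i))
  root-far-from-hole h outside i (j , e) = contradiction
    (subst (λ b → not b ≡ true) (root-neighbour {a = OddHole.C h i} (edge-sym e)) (outside j)) λ ()

corollary5 : (n : ℕ) (G : Graph n) → OddTorchFree G → TriangleFree G → ChromaticAtMost G 3
corollary5 n G torch-free tf = extend-by-stable {G = G} {S} (rootNeighbour-stable G tf) (bipartite no-odd)
  where
  S : Fin n → Bool
  S = rootNeighbour G
  open Walks (restrict G (not ∘ S)) using (OddClosedWalk; bipartite)
  no-odd : ¬ ∃ OddClosedWalk
  no-odd odd-walk
    with unrestrict {A = not ∘ S} (oddHole (restrict-triangleFree {G = G} {not ∘ S} tf) odd-walk)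
  ... | h , outside = torch-free (oddTorch-from-walk h tf i₀ (proj₂ (Walks.root-reach G _))
                                                     (root-far-from-hole G h outside i₀))
    where
    i₀ : Fin (OddHole.k h)
    i₀ = fromℕ< (≤-trans (s≤s z≤n) (OddHole.4≤k h))
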